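{- Let $G$ be a graph with a cut vertex $v$, and let $G=H_1\vee H_2$ be a decomposition associated to $v$. For $D_1\in\operatorname{Div}(H_1)$, $D_2\in\operatorname{Div}(H_2)$ let $D_1+D_2\in\operatorname{Div}(G)$ be the divisor with $(D_1+D_2)(v)=D_1(v)+D_2(v)$, $(D_1+D_2)(u)=D_1(u)$ for $u\in V(H_1)\setminus\{v\}$ and $(D_1+D_2)(u)=D_2(u)$ for $u\in V(H_2)\setminus\{v\}$. Let $j\in\{1,2\}$ and let $\iota^j_*:\operatorname{Div}(H_j)\to\operatorname{Div}(G)$ be extension by zero. Then: (1) The map $\operatorname{Div}(H_1)\oplus\operatorname{Div}(H_2)\to\operatorname{Div}(G)$, $(D_1,D_2)\mapsto D_1+D_2$, is a surjective homomorphism with kernel isomorphic to $\mathbb{Z}$; it induces an isomorphism $\operatorname{Prin}(H_1)\oplus\operatorname{Prin}(H_2)\cong\operatorname{Prin}(G)$ and an exact sequence $0\to\mathbb{Z}\to\operatorname{Jac}(H_1)\oplus\operatorname{Jac}(H_2)\to\operatorname{Jac}(G)\to0$. (2) The maps $\iota^j_*$ fit into a commutative diagram with injective vertical arrows between the exact sequences $0\to\operatorname{Prin}(H_j)\to\operatorname{Div}(H_j)\to\operatorname{Jac}(H_j)\to0$ and $0\to\operatorname{Prin}(G)\to\operatorname{Div}(G)\to\operatorname{Jac}(G)\to0$; i.e. $\iota^j_*$ maps $\operatorname{Prin}(H_j)$ into $\operatorname{Prin}(G)$ and the induced maps $\operatorname{Prin}(H_j)\to\operatorname{Prin}(G)$,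 $\operatorname{Jac}(H_j)\to\operatorname{Jac}(G)$ are injective. (3) For every $D_1\in\operatorname{Div}(H_1)$, $D_2\in\operatorname{Div}(H_2)$ we have $r_G(D_1+D_2)\ge\min\{r_{H_1}(D_1),r_{H_2}(D_2)\}$. (4) For every $D_j\in\operatorname{Div}(H_j)$ we have $r_{H_j}(D_j)\ge r_G(\iota^j_*D_j)$.
   Context: Graphs are finite and connected, loops and multiple edges allowed. $\operatorname{Div}(G)$ is the free abelian group on $V(G)$; for $D=\sum D(v)v$, $\deg D=\sum D(v)$, and $D$ is effective ($D\ge0$) if all $D(v)\ge0$. For vertices $v\ne w$, $(v\cdot w)$ is the number of edges joining $v$ and $w$, and $(v\cdot v)=-\operatorname{val}(v)+2\operatorname{loop}(v)$, where $\operatorname{val}(v)$ is the valency (a loop counted twice) and $\operatorname{loop}(v)$ the number of loops at $v$. Set $T_v=\sum_{w\in V(G)}(v\cdot w)w$; $\operatorname{Prin}(G)$ is the subgroup generated by all $T_v$, $D\sim D'$ iff $D-D'\in\operatorname{Prin}(G)$, and $\operatorname{Jac}(G)=\operatorname{Div}(G)/\operatorname{Prin}(G)$. $|D|$ is the set of effective divisors linearly equivalent to $D$. The rank $r_G(D)$ is $-1$ if $|D|=\emptyset$, and otherwise the maximum $k\ge0$ such that $|D-E|\ne\emptyset$ for every effective $E$ of degree $k$. A decomposition $G=H_1\vee H_2$ associated to a cut vertex $v$ means $H_1,H_2$ are connected subgraphs with $G=H_1\cup H_2$, $V(H_1)\cap V(H_2)=\{v\}$ and $E(H_1)\cap E(H_2)=\emptyset$.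 -}

module Defs where

open import Data.Nat as ℕ using (ℕ; zero; suc)
open import Data.Integer as ℤ using (ℤ; +_; 0ℤ; _+_; _-_; _*_; -_; -1ℤ)
open import Data.Fin using (Fin; zero; suc)
open import Data.Fin.Properties using (_≟_)
open import Data.Bool using (Bool; true; false; if_then_else_; _∧_; _∨_)
open import Data.Maybe using (Maybe; just; nothing; maybe)
import Data.Maybe as Maybe
open import Data.Product using (Σ; ∃; _×_; _,_)
open import Data.Sum using (_⊎_)
open import Data.Unit using (⊤)
open import Function using (_∘_)
open import Relation.Nullary using (¬_; yes; no)
open import Relation.Nullary.Decidable using (⌊_⌋)
open import Relation.Binary.PropositionalEquality using (_≡_; _≢_)

count : ∀ {m} → (Fin m → Bool) → ℕ
count {zero}  p = 0
count {suc m} p = (if p zero then 1 else 0) ℕ.+ count (p ∘ suc)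

sumℤ : ∀ {n} → (Fin n → ℤ) → ℤ
sumℤ {zero}  f = 0ℤ
sumℤ {suc n} f = f zero + sumℤ (f ∘ suc)

-- Loops (src e ≡ tgt e) and multiple
-- edges are allowed.  Orientation is irrelevant for everything below.

record Graph : Set where
  field
    nV  : ℕ
    nE  : ℕ
    src : Fin nE → Fin nV
    tgt : Fin nE → Fin nV

open Graph public

Vtx : Graph → Set
Vtx G = Fin (nV G)

Edg : Graph → Set
Edg G = Fin (nE G)

data Walk (G : Graph) (ok : Vtx G → Set) (u : Vtx G) : Vtx G → Set where
  here  : Walk G ok u u
  fwd   : ∀ {w x} → Walk G ok u w → (e : Edg G) →
          src G e ≡ w → tgt G e ≡ x → ok x → Walk G ok u x
  bwd   : ∀ {w x} → Walk G ok u w → (e : Edg G) →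
          tgt G e ≡ w → src G e ≡ x → ok x → Walk G ok u x

Connected : Graph → Set
Connected G = ∀ (u w : Vtx G) → Walk G (λ _ → ⊤) u w

IsCutVertex : (G : Graph) → Vtx G → Set
IsCutVertex G v = Σ (Vtx G) λ u → Σ (Vtx G) λ w →
  u ≢ v × w ≢ v × ¬ Walk G (λ x → x ≢ v) u w

loop : (G : Graph) → Vtx G → ℕ
loop G v = count (λ e → ⌊ src G e ≟ v ⌋ ∧ ⌊ tgt G e ≟ v ⌋)

-- valency (a loop counted twice)
val : (G : Graph) → Vtx G → ℕ
val G v = count (λ e → ⌊ src G e ≟ v ⌋) ℕ.+ count (λ e → ⌊ tgt G e ≟ v ⌋)

joining : (G : Graph) → Vtx G → Vtx G → ℕ
joining G v w = count (λ e → (⌊ src G e ≟ v ⌋ ∧ ⌊ tgt G e ≟ w ⌋)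
                           ∨ (⌊ src G e ≟ w ⌋ ∧ ⌊ tgt G e ≟ v ⌋))

dot : (G : Graph) → Vtx G → Vtx G → ℤ
dot G v w with v ≟ w
... | yes _ = - (+ val G v) + (+ 2) * (+ loop G v)
... | no  _ = + joining G v w

Div : Graph → Set
Div G = Vtx G → ℤ

infix 4 _≋_
_≋_ : ∀ {n} → (Fin n → ℤ) → (Fin n → ℤ) → Set
D ≋ D' = ∀ u → D u ≡ D' u

infixl 6 _+ᴰ_ _-ᴰ_
_+ᴰ_ : ∀ {n} → (Fin n → ℤ) → (Fin n → ℤ) → (Fin n → ℤ)
(D +ᴰ D') u = D u + D' u

_-ᴰ_ : ∀ {n} → (Fin n → ℤ) → (Fin n → ℤ) → (Fin n → ℤ)
(D -ᴰ D') u = D u - D' u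

0ᴰ : ∀ {n} → (Fin n → ℤ)
0ᴰ u = 0ℤ

deg : ∀ {n} → (Fin n → ℤ) → ℤ
deg D = sumℤ D

Effective : ∀ {n} → (Fin n → ℤ) → Set
Effective D = ∀ u → 0ℤ ℤ.≤ D u

T : (G : Graph) → Vtx G → Div G
T G v w = dot G v w

IsPrin : (G : Graph) → Div G → Set
IsPrin G D = Σ (Vtx G → ℤ) λ c → ∀ w → D w ≡ sumℤ (λ u → c u * T G u w)

LinEq : (G : Graph) → Div G → Div G → Set
LinEq G D D' = IsPrin G (D -ᴰ D')

LinSysNonempty : (G : Graph) → Div G → Set
LinSysNonempty G D = Σ (Div G) λ D' → Effective D' × LinEq G D' D

RankCond : (G : Graph) → Div G → ℕ → Set
RankCond G D k = ∀ (E : Div G) → Effective E → deg E ≡ + k →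
                 LinSysNonempty G (D -ᴰ E)

Rank : (G : Graph) → Div G → ℤ → Set
Rank G D r =
    (¬ LinSysNonempty G D × r ≡ -1ℤ)
  ⊎ (LinSysNonempty G D × Σ ℕ λ k → r ≡ + k × RankCond G D k ×
       (∀ k' → RankCond G D k' → k' ℕ.≤ k))

record Subgraph (H G : Graph) : Set where
  field
    φ       : Vtx H → Vtx G
    ψ       : Edg H → Edg G
    φ-inj   : ∀ x y → φ x ≡ φ y → x ≡ y
    ψ-inj   : ∀ e f → ψ e ≡ ψ f → e ≡ f
    src-ψ   : ∀ e → src G (ψ e) ≡ φ (src H e)
    tgt-ψ   : ∀ e → tgt G (ψ e) ≡ φ (tgt H e)

open Subgraph public

preimage : ∀ {k n} → (Fin k → Fin n) → Fin n → Maybe (Fin k)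
preimage {zero}  f u = nothing
preimage {suc k} f u with f zero ≟ u
... | yes _ = just zero
... | no  _ = Maybe.map suc (preimage (f ∘ suc) u)

push : ∀ {H G} → Subgraph H G → Div H → Div G
push ι D u = maybe D 0ℤ (preimage (φ ι) u)

record Decomposition (G : Graph) (v : Vtx G) : Set₁ where
  field
    H₁ H₂   : Graph
    conn₁   : Connected H₁
    conn₂   : Connected H₂
    ι₁      : Subgraph H₁ G
    ι₂      : Subgraph H₂ G
    V-cover : ∀ u → (∃ λ x → φ ι₁ x ≡ u) ⊎ (∃ λ y → φ ι₂ y ≡ u)
    v∈H₁    : ∃ λ x → φ ι₁ x ≡ v
    v∈H₂    : ∃ λ y → φ ι₂ y ≡ v
    V-meet  : ∀ x y → φ ι₁ x ≡ φ ι₂ y → φ ι₁ x ≡ v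
    E-cover : ∀ e → (∃ λ e₁ → ψ ι₁ e₁ ≡ e) ⊎ (∃ λ e₂ → ψ ι₂ e₂ ≡ e)
    E-disj  : ∀ e₁ e₂ → ψ ι₁ e₁ ≢ ψ ι₂ e₂

  -- H_j and ι^j for j ∈ {1,2} (j = zero means 1, j = suc zero means 2)
  Hj : Fin 2 → Graph
  Hj zero       = H₁
  Hj (suc zero) = H₂

  ιj : (j : Fin 2) → Subgraph (Hj j) G
  ιj zero       = ι₁
  ιj (suc zero) = ι₂

  _⊞_ : Div H₁ → Div H₂ → Div G
  D₁ ⊞ D₂ = push ι₁ D₁ +ᴰ push ι₂ D₂

module Submission where

-- Everything rests on one identity.  The intersection matrix factors through the incidence
-- matrix, (u·w) = -Σ_e inc(e,u) inc(e,w), so the principal divisor div_G(c) = Σ_u c(u) T_u is a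
-- sum over edges, Σ_e (c(tgt e) - c(src e)) inc(e,·).  As E(G) = E(H₁) ⊔ E(H₂), this gives
--     div_G(c) = div_{H₁}(c|H₁) + div_{H₂}(c|H₂)                                  (prinDiv-⊞)
-- and shows that principal divisors have degree 0.  With the elementary fact that
-- (D₁ , D₂) ↦ D₁ + D₂ is onto with kernel {(a·v , -a·v)} ≅ ℤ, parts (1) and (2) follow: a kernel
-- element with a principal component has degree 0, hence vanishes.  For ranks, an effective
-- divisor splits as E₁ + E₂ with both parts effective (part 3), and an effective divisor of G
-- equivalent to ι¹_* A is (A + P₁) + P₂ with P₂ principal, nonnegative off v and so ≤ 0 at v,
-- making A + P₁ effective (part 4).

open import Defs
open import Data.Nat as ℕ using (zero; suc)
import Data.Nat.Properties as ℕP
open import Data.Integer as ℤ using (ℤ; +_; 0ℤ; 1ℤ; -1ℤ; _+_; _-_; _*_; -_; _≤_; _⊓_)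
import Data.Integer.Properties as ℤP
open import Data.Integer.Tactic.RingSolver using (solve-∀)
open import Data.Fin using (Fin; zero; suc)
open import Data.Fin.Properties using (_≟_)
import Data.Fin.Properties as FinP
open import Data.Bool using (Bool; true; false; _∧_; _∨_; if_then_else_)
open import Data.Maybe using (just; nothing; maybe)
open import Data.Product using (Σ; _×_; _,_; proj₁; proj₂)
open import Data.Sum using (_⊎_; inj₁; inj₂)
import Data.Sum as Sum
open import Function using (_∘_)
open import Function.Definitions using (Injective)
open import Relation.Nullary using (yes; no; contradiction)
open import Relation.Nullary.Decidable using (⌊_⌋; dec-true; dec-false; isYes≗does; ⌊⌋-map′)
open import Relation.Binary.PropositionalEquality
open import Algebra.Properties.AbelianGroup ℤP.+-0-abelianGroup using (inverseʳ-unique)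

χ : Bool → ℤ
χ true  = 1ℤ
χ false = 0ℤ

δ : ∀ {n} → Fin n → Fin n → ℤ
δ x w = χ ⌊ x ≟ w ⌋

point : ∀ {n} → Fin n → ℤ → (Fin n → ℤ)
point x a w = a * δ x w

≟-yes : ∀ {n} {x w : Fin n} → x ≡ w → ⌊ x ≟ w ⌋ ≡ true
≟-yes {x = x} {w} x≡w = trans (isYes≗does (x ≟ w)) (dec-true (x ≟ w) x≡w)

≟-no : ∀ {n} {x w : Fin n} → x ≢ w → ⌊ x ≟ w ⌋ ≡ false
≟-no {x = x} {w} x≢w = trans (isYes≗does (x ≟ w)) (dec-false (x ≟ w) x≢w)

-- Values of the delta; δ (suc x) (suc w) is δ x w only up to propositional equality.
δ-diag : ∀ {n} (x : Fin n) → δ x x ≡ 1ℤ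
δ-diag x = cong χ (≟-yes refl)

δ-off : ∀ {n} {x w : Fin n} → x ≢ w → δ x w ≡ 0ℤ
δ-off x≢w = cong χ (≟-no x≢w)

δ-suc : ∀ {n} (x w : Fin n) → δ (suc x) (suc w) ≡ δ x w
δ-suc x w = cong χ (⌊⌋-map′ _ _ (x ≟ w))

sum-cong : ∀ {n} {f g : Fin n → ℤ} → f ≋ g → sumℤ f ≡ sumℤ g
sum-cong {zero}  f≋g = refl
sum-cong {suc n} f≋g = cong₂ _+_ (f≋g zero) (sum-cong (f≋g ∘ suc))

sum-zero : ∀ {n} {f : Fin n → ℤ} → f ≋ 0ᴰ → sumℤ f ≡ 0ℤ
sum-zero {zero}  f≋0 = refl
sum-zero {suc n} f≋0 = cong₂ _+_ (f≋0 zero) (sum-zero (f≋0 ∘ suc))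

sum-+ : ∀ {n} (f g : Fin n → ℤ) → sumℤ (f +ᴰ g) ≡ sumℤ f + sumℤ g
sum-+ {zero}  f g = refl
sum-+ {suc n} f g = begin
  f zero + g zero + sumℤ ((f +ᴰ g) ∘ suc)
    ≡⟨ cong (_+_ (f zero + g zero)) (sum-+ (f ∘ suc) (g ∘ suc)) ⟩
  f zero + g zero + (sumℤ (f ∘ suc) + sumℤ (g ∘ suc))
    ≡⟨ interchange (f zero) (g zero) _ _ ⟩
  f zero + sumℤ (f ∘ suc) + (g zero + sumℤ (g ∘ suc)) ∎
  where
  open ≡-Reasoning
  interchange : ∀ a b c d → a + b + (c + d) ≡ a + c + (b + d)
  interchange = solve-∀

sum-neg : ∀ {n} (f : Fin n → ℤ) → sumℤ (λ u → - f u) ≡ - sumℤ f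
sum-neg {zero}  f = refl
sum-neg {suc n} f = trans (cong (_+_ (- f zero)) (sum-neg (f ∘ suc)))
                          (sym (ℤP.neg-distrib-+ (f zero) (sumℤ (f ∘ suc))))

sum-- : ∀ {n} (f g : Fin n → ℤ) → sumℤ (f -ᴰ g) ≡ sumℤ f - sumℤ g
sum-- f g = trans (sum-+ f (λ u → - g u)) (cong (_+_ (sumℤ f)) (sum-neg g))

sum-*ˡ : ∀ {n} (c : ℤ) (f : Fin n → ℤ) → sumℤ (λ u → c * f u) ≡ c * sumℤ f
sum-*ˡ {zero}  c f = sym (ℤP.*-zeroʳ c)
sum-*ˡ {suc n} c f = trans (cong (_+_ (c * f zero)) (sum-*ˡ c (f ∘ suc)))
                           (sym (ℤP.*-distribˡ-+ c (f zero) (sumℤ (f ∘ suc))))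

sum-*ʳ : ∀ {n} (c : ℤ) (f : Fin n → ℤ) → sumℤ (λ u → f u * c) ≡ sumℤ f * c
sum-*ʳ c f = trans (sum-cong (λ u → ℤP.*-comm (f u) c))
                   (trans (sum-*ˡ c f) (ℤP.*-comm c (sumℤ f)))

sum-swap : ∀ {m n} (f : Fin m → Fin n → ℤ) →
  sumℤ (λ w → sumℤ (λ u → f u w)) ≡ sumℤ (λ u → sumℤ (λ w → f u w))
sum-swap {m} {zero}  f = sym (sum-zero {m} (λ _ → refl))
sum-swap {m} {suc n} f =
  trans (cong (_+_ (sumℤ (λ u → f u zero))) (sum-swap (λ u w → f u (suc w))))
        (sym (sum-+ (λ u → f u zero) (λ u → sumℤ (λ w → f u (suc w)))))

sum-nonneg : ∀ {n} (f : Fin n → ℤ) → Effective f → 0ℤ ≤ sumℤ f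
sum-nonneg {zero}  f f≥0 = ℤP.≤-refl
sum-nonneg {suc n} f f≥0 = ℤP.+-mono-≤ (f≥0 zero) (sum-nonneg (f ∘ suc) (f≥0 ∘ suc))

term-≤-sum : ∀ {n} (f : Fin n → ℤ) (x : Fin n) →
  (∀ w → w ≢ x → 0ℤ ≤ f w) → f x ≤ sumℤ f
term-≤-sum {suc n} f zero    others =
  ℤP.≤-trans (ℤP.≤-reflexive (sym (ℤP.+-identityʳ (f zero))))
             (ℤP.+-monoʳ-≤ (f zero) (sum-nonneg (f ∘ suc) (λ w → others (suc w) λ ())))
term-≤-sum {suc n} f (suc x) others =
  ℤP.≤-trans (ℤP.≤-reflexive (sym (ℤP.+-identityˡ (f (suc x)))))
             (ℤP.+-mono-≤ (others zero λ ()) (term-≤-sum (f ∘ suc) x (λ w w≢x → others (suc w) (w≢x ∘ FinP.suc-injective))))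

sum-δ : ∀ {n} (f : Fin n → ℤ) (x : Fin n) → sumℤ (λ w → f w * δ x w) ≡ f x
sum-δ {suc n} f zero = begin
  f zero * 1ℤ + sumℤ (λ w → f (suc w) * 0ℤ)
    ≡⟨ cong₂ _+_ (ℤP.*-identityʳ (f zero)) (sum-zero (λ w → ℤP.*-zeroʳ (f (suc w)))) ⟩
  f zero + 0ℤ
    ≡⟨ ℤP.+-identityʳ (f zero) ⟩
  f zero ∎
  where open ≡-Reasoning
sum-δ {suc n} f (suc x) = begin
  f zero * 0ℤ + sumℤ (λ w → f (suc w) * δ (suc x) (suc w))
    ≡⟨ cong₂ _+_ (ℤP.*-zeroʳ (f zero)) (sum-cong (λ w → cong (f (suc w) *_) (δ-suc x w))) ⟩
  0ℤ + sumℤ (λ w → f (suc w) * δ x w)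
    ≡⟨ ℤP.+-identityˡ _ ⟩
  sumℤ (λ w → f (suc w) * δ x w)
    ≡⟨ sum-δ (f ∘ suc) x ⟩
  f (suc x) ∎
  where open ≡-Reasoning

deg-point : ∀ {n} (x : Fin n) (a : ℤ) → deg (point x a) ≡ a
deg-point x a = sum-δ (λ _ → a) x

point-at : ∀ {n} (x : Fin n) a → point x a x ≡ a
point-at x a = trans (cong (a *_) (δ-diag x)) (ℤP.*-identityʳ a)

point-+ : ∀ {n} (x : Fin n) a b → point x (a + b) ≋ point x a +ᴰ point x b
point-+ x a b w = ℤP.*-distribʳ-+ (δ x w) a b

-- Extension by zero along a map f : Fin m → Fin n; push ι is definitionally extend (φ ι).

extend : ∀ {m n} → (Fin m → Fin n) → (Fin m → ℤ) → (Fin n → ℤ)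
extend f g w = maybe g 0ℤ (preimage f w)

preimage-just : ∀ {m n} (f : Fin m → Fin n) {w x} → preimage f w ≡ just x → f x ≡ w
preimage-just {suc m} f {w} eq with f zero ≟ w
preimage-just {suc m} f refl | yes fz≡w = fz≡w
... | no _ with preimage (f ∘ suc) w in eq′
preimage-just {suc m} f refl | no _ | just y = preimage-just (f ∘ suc) eq′

preimage-nothing : ∀ {m n} (f : Fin m → Fin n) {w} → preimage f w ≡ nothing → ∀ x → f x ≢ w
preimage-nothing {suc m} f {w} eq x with f zero ≟ w
preimage-nothing {suc m} f () x | yes _
... | no fz≢w with preimage (f ∘ suc) w in eq′
... | nothing with x
...   | zero  = fz≢w
...   | suc y = preimage-nothing (f ∘ suc) eq′ y

extend-hit : ∀ {m n} (f : Fin m → Fin n) → Injective _≡_ _≡_ f →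
  ∀ g x → extend f g (f x) ≡ g x
extend-hit f inj g x with preimage f (f x) in eq
... | just y  = cong g (inj (preimage-just f eq))
... | nothing = contradiction refl (preimage-nothing f eq x)

extend-miss : ∀ {m n} (f : Fin m → Fin n) g {w} → (∀ x → f x ≢ w) → extend f g w ≡ 0ℤ
extend-miss f g {w} miss with preimage f w in eq
... | just x  = contradiction (preimage-just f eq) (miss x)
... | nothing = refl

extend-cong : ∀ {m n} (f : Fin m → Fin n) {g h} → g ≋ h → extend f g ≋ extend f h
extend-cong f g≋h w with preimage f w
... | just x  = g≋h x
... | nothing = refl

extend-+ : ∀ {m n} (f : Fin m → Fin n) g h → extend f (g +ᴰ h) ≋ extend f g +ᴰ extend f h
extend-+ f g h w with preimage f w
... | just x  = refl
... | nothing = refl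

extend-- : ∀ {m n} (f : Fin m → Fin n) g h → extend f (g -ᴰ h) ≋ extend f g -ᴰ extend f h
extend-- f g h w with preimage f w
... | just x  = refl
... | nothing = refl

extend-0 : ∀ {m n} (f : Fin m → Fin n) → extend f 0ᴰ ≋ 0ᴰ
extend-0 f w with preimage f w
... | just x  = refl
... | nothing = refl

extend-effective : ∀ {m n} (f : Fin m → Fin n) g → Effective g → Effective (extend f g)
extend-effective f g g≥0 w with preimage f w
... | just x  = g≥0 x
... | nothing = ℤP.≤-refl

extend-* : ∀ {m n} (f : Fin m → Fin n) a g → extend f (λ x → a * g x) ≋ (λ w → a * extend f g w)
extend-* f a g w with preimage f w
... | just x  = refl
... | nothing = sym (ℤP.*-zeroʳ a)

extend-lincomb : ∀ {m n k} (f : Fin m → Fin n) (a : Fin k → ℤ) (g : Fin k → Fin m → ℤ) w →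
  extend f (λ x → sumℤ (λ e → a e * g e x)) w ≡ sumℤ (λ e → a e * extend f (g e) w)
extend-lincomb f a g w with preimage f w
... | just x  = refl
... | nothing = sym (sum-zero (λ e → ℤP.*-zeroʳ (a e)))

δ-inj : ∀ {m n} (f : Fin m → Fin n) → Injective _≡_ _≡_ f → ∀ x y → δ (f x) (f y) ≡ δ x y
δ-inj f inj x y with x ≟ y
... | yes refl = δ-diag (f x)
... | no x≢y   = δ-off (x≢y ∘ inj)

extend-δ : ∀ {m n} (f : Fin m → Fin n) → Injective _≡_ _≡_ f → ∀ x → extend f (δ x) ≋ δ (f x)
extend-δ f inj x w with preimage f w in eq
... | just y  = trans (sym (δ-inj f inj x y)) (cong (δ (f x)) (preimage-just f eq))
... | nothing = sym (δ-off (preimage-nothing f eq x))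

extend-point : ∀ {m n} (f : Fin m → Fin n) → Injective _≡_ _≡_ f → ∀ x a → extend f (point x a) ≋ point (f x) a
extend-point f inj x a w = trans (extend-* f a (δ x) w) (cong (a *_) (extend-δ f inj x w))

residual-effective : ∀ {m n} (f : Fin m → Fin n) (D : Fin n → ℤ) →
  Effective D → Effective (D -ᴰ extend f (D ∘ f))
residual-effective f D D≥0 w with preimage f w in eq
... | just x  rewrite preimage-just f eq = ℤP.≤-reflexive (sym (ℤP.+-inverseʳ (D w)))
... | nothing = ℤP.≤-trans (D≥0 w) (ℤP.≤-reflexive (sym (ℤP.+-identityʳ (D w))))

extend-step : ∀ {m n} (f : Fin (suc m) → Fin n) → Injective _≡_ _≡_ f → ∀ g →
  extend f g ≋ point (f zero) (g zero) +ᴰ extend (f ∘ suc) (g ∘ suc)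
extend-step f inj g w with f zero ≟ w
... | yes refl = sym (trans (cong₂ _+_ (ℤP.*-identityʳ (g zero)) (extend-miss (f ∘ suc) (g ∘ suc) miss))
                            (ℤP.+-identityʳ (g zero)))
  where miss : ∀ x → f (suc x) ≢ f zero
        miss x e with inj e
        ... | ()
... | no _ with preimage (f ∘ suc) w
...   | just y  = sym (vanish (g (suc y)))
  where vanish : ∀ t → g zero * 0ℤ + t ≡ t
        vanish t = trans (cong (_+ t) (ℤP.*-zeroʳ (g zero))) (ℤP.+-identityˡ t)
...   | nothing = sym (trans (ℤP.+-identityʳ _) (ℤP.*-zeroʳ (g zero)))

sum-extend : ∀ {m n} (f : Fin m → Fin n) → Injective _≡_ _≡_ f → ∀ g → sumℤ (extend f g) ≡ sumℤ g
sum-extend {zero} {n} f inj g = sum-zero {n} (λ _ → refl)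
sum-extend {suc m} f inj g = begin
  sumℤ (extend f g)
    ≡⟨ sum-cong (extend-step f inj g) ⟩
  sumℤ (point (f zero) (g zero) +ᴰ extend (f ∘ suc) (g ∘ suc))
    ≡⟨ sum-+ (point (f zero) (g zero)) (extend (f ∘ suc) (g ∘ suc)) ⟩
  sumℤ (point (f zero) (g zero)) + sumℤ (extend (f ∘ suc) (g ∘ suc))
    ≡⟨ cong₂ _+_ (deg-point (f zero) (g zero)) (sum-extend (f ∘ suc) (FinP.suc-injective ∘ inj) (g ∘ suc)) ⟩
  g zero + sumℤ (g ∘ suc) ∎
  where open ≡-Reasoning

count-sum : ∀ {n} (p : Fin n → Bool) → + count p ≡ sumℤ (χ ∘ p)
count-sum {zero}  p = refl
count-sum {suc n} p = trans (ℤP.pos-+ _ (count (p ∘ suc))) (cong₂ _+_ (indicator (p zero)) (count-sum (p ∘ suc)))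
  where indicator : ∀ b → + (if b then 1 else 0) ≡ χ b
        indicator true  = refl
        indicator false = refl

-- inc G e w = [src e = w] - [tgt e = w]; a loop has incidence 0 everywhere.
inc : (G : Graph) → Edg G → Vtx G → ℤ
inc G e w = δ (src G e) w - δ (tgt G e) w

-- The edge-wise identities behind dot-incidence.  On the diagonal an edge e = (s,t) contributes
-- -([s=u] + [t=u]) + 2[s=u][t=u] to (u·u); off it, [e joins u and w], where no endpoint is both.
self-incidence : ∀ a b → - (χ a + χ b) + + 2 * χ (a ∧ b) ≡ - ((χ a - χ b) * (χ a - χ b))
self-incidence true  true  = refl
self-incidence true  false = refl
self-incidence false true  = refl
self-incidence false false = refl

cross-incidence : ∀ a b c d → a ∧ c ≡ false → b ∧ d ≡ false →
  χ ((a ∧ d) ∨ (c ∧ b)) ≡ - ((χ a - χ b) * (χ c - χ d))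
cross-incidence true  _     true  _     ()
cross-incidence _     true  _     true  _  ()
cross-incidence true  true  false false _  _ = refl
cross-incidence true  false false true  _  _ = refl
cross-incidence true  false false false _  _ = refl
cross-incidence false true  true  false _  _ = refl
cross-incidence false true  false false _  _ = refl
cross-incidence false false true  true  _  _ = refl
cross-incidence false false true  false _  _ = refl
cross-incidence false false false true  _  _ = refl
cross-incidence false false false false _  _ = refl

exclusive : ∀ {n} {u w : Fin n} → u ≢ w → ∀ s → ⌊ s ≟ u ⌋ ∧ ⌊ s ≟ w ⌋ ≡ false
exclusive {u = u} u≢w s with s ≟ u
... | yes refl = ≟-no u≢w
... | no _     = refl

dot-incidence : ∀ G u w → dot G u w ≡ sumℤ (λ e → - (inc G e u * inc G e w))
dot-incidence G u w with u ≟ w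
dot-incidence G u .u | yes refl = begin
  - (+ val G u) + + 2 * + loop G u
    ≡⟨ cong₂ (λ a b → - a + + 2 * b)
             (trans (ℤP.pos-+ (count s) (count t)) (cong₂ _+_ (count-sum s) (count-sum t)))
             (count-sum (λ e → s e ∧ t e)) ⟩
  - (sumℤ (χ ∘ s) + sumℤ (χ ∘ t)) + + 2 * sumℤ (λ e → χ (s e ∧ t e))
    ≡⟨ sym (cong₂ _+_ (trans (sum-neg ((χ ∘ s) +ᴰ (χ ∘ t))) (cong -_ (sum-+ (χ ∘ s) (χ ∘ t))))
                      (sum-*ˡ (+ 2) (λ e → χ (s e ∧ t e)))) ⟩
  sumℤ (λ e → - (χ (s e) + χ (t e))) + sumℤ (λ e → + 2 * χ (s e ∧ t e))
    ≡⟨ sym (sum-+ (λ e → - (χ (s e) + χ (t e))) (λ e → + 2 * χ (s e ∧ t e))) ⟩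
  sumℤ (λ e → - (χ (s e) + χ (t e)) + + 2 * χ (s e ∧ t e))
    ≡⟨ sum-cong (λ e → self-incidence (s e) (t e)) ⟩
  sumℤ (λ e → - (inc G e u * inc G e u)) ∎
  where
  open ≡-Reasoning
  s t : Edg G → Bool
  s e = ⌊ src G e ≟ u ⌋
  t e = ⌊ tgt G e ≟ u ⌋
... | no u≢w = trans (count-sum joins) (sum-cong λ e →
        cross-incidence ⌊ src G e ≟ u ⌋ ⌊ tgt G e ≟ u ⌋ ⌊ src G e ≟ w ⌋ ⌊ tgt G e ≟ w ⌋
                        (exclusive u≢w (src G e)) (exclusive u≢w (tgt G e)))
  where
  joins : Edg G → Bool
  joins e = (⌊ src G e ≟ u ⌋ ∧ ⌊ tgt G e ≟ w ⌋) ∨ (⌊ src G e ≟ w ⌋ ∧ ⌊ tgt G e ≟ u ⌋)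

prinDiv : (G : Graph) → (Vtx G → ℤ) → Div G
prinDiv G c w = sumℤ (λ u → c u * T G u w)

gradient : (G : Graph) → (Vtx G → ℤ) → Edg G → ℤ
gradient G c e = c (tgt G e) - c (src G e)

sum-inc : ∀ G (c : Vtx G → ℤ) e → sumℤ (λ u → c u * inc G e u) ≡ c (src G e) - c (tgt G e)
sum-inc G c e = begin
  sumℤ (λ u → c u * (δ s u - δ t u))
    ≡⟨ sum-cong (λ u → distrib (c u) (δ s u) (δ t u)) ⟩
  sumℤ (λ u → c u * δ s u - c u * δ t u)
    ≡⟨ sum-- (λ u → c u * δ s u) (λ u → c u * δ t u) ⟩
  sumℤ (λ u → c u * δ s u) - sumℤ (λ u → c u * δ t u)
    ≡⟨ cong₂ _-_ (sum-δ c s) (sum-δ c t) ⟩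
  c s - c t ∎
  where
  open ≡-Reasoning
  s t : Vtx G
  s = src G e
  t = tgt G e
  distrib : ∀ a b d → a * (b - d) ≡ a * b - a * d
  distrib = solve-∀

prinDiv-edges : ∀ G c w → prinDiv G c w ≡ sumℤ (λ e → gradient G c e * inc G e w)
prinDiv-edges G c w = begin
  sumℤ (λ u → c u * dot G u w)
    ≡⟨ sum-cong (λ u → cong (c u *_) (dot-incidence G u w)) ⟩
  sumℤ (λ u → c u * sumℤ (λ e → - (inc G e u * inc G e w)))
    ≡⟨ sum-cong (λ u → sym (sum-*ˡ (c u) (λ e → - (inc G e u * inc G e w)))) ⟩
  sumℤ (λ u → sumℤ (λ e → c u * - (inc G e u * inc G e w)))
    ≡⟨ sum-swap (λ e u → c u * - (inc G e u * inc G e w)) ⟩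
  sumℤ (λ e → sumℤ (λ u → c u * - (inc G e u * inc G e w)))
    ≡⟨ sum-cong edge-term ⟩
  sumℤ (λ e → gradient G c e * inc G e w) ∎
  where
  open ≡-Reasoning
  regroup : ∀ a i j → a * - (i * j) ≡ a * i * - j
  regroup = solve-∀
  flip : ∀ a b j → (a - b) * - j ≡ (b - a) * j
  flip = solve-∀
  edge-term : ∀ e → sumℤ (λ u → c u * - (inc G e u * inc G e w)) ≡ gradient G c e * inc G e w
  edge-term e = begin
    sumℤ (λ u → c u * - (inc G e u * inc G e w))
      ≡⟨ sum-cong (λ u → regroup (c u) (inc G e u) (inc G e w)) ⟩
    sumℤ (λ u → c u * inc G e u * - inc G e w)
      ≡⟨ sum-*ʳ (- inc G e w) (λ u → c u * inc G e u) ⟩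
    sumℤ (λ u → c u * inc G e u) * - inc G e w
      ≡⟨ cong (_* - inc G e w) (sum-inc G c e) ⟩
    (c (src G e) - c (tgt G e)) * - inc G e w
      ≡⟨ flip (c (src G e)) (c (tgt G e)) (inc G e w) ⟩
    gradient G c e * inc G e w ∎

-- Principal divisors have degree 0, since every incidence vector does.
deg-prinDiv : ∀ G c → deg (prinDiv G c) ≡ 0ℤ
deg-prinDiv G c = begin
  sumℤ (prinDiv G c)
    ≡⟨ sum-cong (prinDiv-edges G c) ⟩
  sumℤ (λ w → sumℤ (λ e → gradient G c e * inc G e w))
    ≡⟨ sum-swap (λ e w → gradient G c e * inc G e w) ⟩
  sumℤ (λ e → sumℤ (λ w → gradient G c e * inc G e w))
    ≡⟨ sum-cong (λ e → sum-*ˡ (gradient G c e) (inc G e)) ⟩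
  sumℤ (λ e → gradient G c e * sumℤ (inc G e))
    ≡⟨ sum-zero (λ e → trans (cong (gradient G c e *_) (inc-total e)) (ℤP.*-zeroʳ (gradient G c e))) ⟩
  0ℤ ∎
  where
  open ≡-Reasoning
  inc-total : ∀ e → sumℤ (inc G e) ≡ 0ℤ
  inc-total e = trans (sum-cong (λ w → sym (ℤP.*-identityˡ (inc G e w)))) (sum-inc G (λ _ → 1ℤ) e)

prinDiv-shift : ∀ G c k → prinDiv G (λ u → c u - k) ≋ prinDiv G c
prinDiv-shift G c k w =
  trans (prinDiv-edges G (λ u → c u - k) w)
        (trans (sum-cong (λ e → cong (_* inc G e w) (cancel (c (tgt G e)) (c (src G e)) k)))
               (sym (prinDiv-edges G c w)))
  where cancel : ∀ a b k → (a - k) - (b - k) ≡ a - b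
        cancel = solve-∀

prinDiv-cong : ∀ G {c c'} → c ≋ c' → prinDiv G c ≋ prinDiv G c'
prinDiv-cong G c≋c' w = sum-cong (λ u → cong (_* T G u w) (c≋c' u))

prinDiv-- : ∀ G c c' → prinDiv G (c -ᴰ c') ≋ prinDiv G c -ᴰ prinDiv G c'
prinDiv-- G c c' w = trans (sum-cong (λ u → distrib (c u) (c' u) (T G u w)))
                           (sum-- (λ u → c u * T G u w) (λ u → c' u * T G u w))
  where distrib : ∀ a b t → (a - b) * t ≡ a * t - b * t
        distrib = solve-∀

prin-resp : ∀ {G D D'} → IsPrin G D → D ≋ D' → IsPrin G D'
prin-resp (c , D≡) D≋D' = c , λ w → trans (sym (D≋D' w)) (D≡ w)

prin-zero : ∀ {G} (D : Div G) → D ≋ 0ᴰ → IsPrin G D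
prin-zero {G} D D≋0 = (λ _ → 0ℤ) , λ w → trans (D≋0 w) (sym (sum-zero {nV G} (λ _ → refl)))

prin-sub : ∀ {G D D'} → IsPrin G D → IsPrin G D' → IsPrin G (D -ᴰ D')
prin-sub {G} (c , D≡) (c' , D'≡) =
  (c -ᴰ c') , λ w → trans (cong₂ _-_ (D≡ w) (D'≡ w)) (sym (prinDiv-- G c c' w))

deg-prin : ∀ {G D} → IsPrin G D → deg D ≡ 0ℤ
deg-prin {G} (c , D≡) = trans (sum-cong D≡) (deg-prinDiv G c)

prin-normalize : ∀ {G D} → IsPrin G D → ∀ x₀ →
  Σ (Vtx G → ℤ) λ c → c x₀ ≡ 0ℤ × (D ≋ prinDiv G c)
prin-normalize {G} (c , D≡) x₀ =
  (λ u → c u - c x₀) , ℤP.+-inverseʳ (c x₀) , λ w → trans (D≡ w) (sym (prinDiv-shift G c (c x₀) w))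

linsys-resp : ∀ {G} {D D' : Div G} → D ≋ D' → LinSysNonempty G D → LinSysNonempty G D'
linsys-resp D≋D' (F , F≥0 , F~D) = F , F≥0 , prin-resp F~D (λ w → cong (_-_ (F w)) (D≋D' w))

linsys-add : ∀ {G} {D P : Div G} → LinSysNonempty G D → Effective P → LinSysNonempty G (D +ᴰ P)
linsys-add {D = D} {P} (F , F≥0 , F~D) P≥0 =
  F +ᴰ P , (λ w → ℤP.+-mono-≤ (F≥0 w) (P≥0 w)) ,
  prin-resp F~D (λ w → cancel (F w) (D w) (P w))
  where cancel : ∀ f d p → f - d ≡ (f + p) - (d + p)
        cancel = solve-∀

point-effective : ∀ {n} (x : Fin n) {a} → 0ℤ ≤ a → Effective (point x a)
point-effective x {a} a≥0 w with x ≟ w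
... | yes _ = ℤP.≤-trans a≥0 (ℤP.≤-reflexive (sym (ℤP.*-identityʳ a)))
... | no _  = ℤP.≤-reflexive (sym (ℤP.*-zeroʳ a))

-- The rank condition for k applies to every effective E of degree at most k
-- (pad E up to degree k at some vertex x₀).
rankcond-≤ : ∀ {G} (x₀ : Vtx G) {D k} → RankCond G D k →
  ∀ E → Effective E → deg E ≤ + k → LinSysNonempty G (D -ᴰ E)
rankcond-≤ {G} x₀ {D} {k} rc E E≥0 degE≤k =
  linsys-resp (λ w → unpad (D w) (E w) (pad w))
    (linsys-add (rc (E +ᴰ pad) (λ w → ℤP.+-mono-≤ (E≥0 w) (point-effective x₀ gap≥0 w)) deg-padded)
                (point-effective x₀ gap≥0))
  where
  open ≡-Reasoning
  gap : ℤ
  gap = + k - deg E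
  gap≥0 : 0ℤ ≤ gap
  gap≥0 = ℤP.i≤j⇒0≤j-i degE≤k
  pad : Div G
  pad = point x₀ gap
  deg-padded : deg (E +ᴰ pad) ≡ + k
  deg-padded = begin
    deg (E +ᴰ pad)          ≡⟨ sum-+ E pad ⟩
    deg E + deg pad         ≡⟨ cong (_+_ (deg E)) (deg-point x₀ gap) ⟩
    deg E + (+ k - deg E)   ≡⟨ fill (deg E) (+ k) ⟩
    + k ∎
    where fill : ∀ e k → e + (k - e) ≡ k
          fill = solve-∀
  unpad : ∀ d e p → d - (e + p) + p ≡ d - e
  unpad = solve-∀

rank-≥-1 : ∀ {G D r} → Rank G D r → -1ℤ ≤ r
rank-≥-1 (inj₁ (_ , refl))         = ℤP.≤-refl
rank-≥-1 (inj₂ (_ , _ , refl , _)) = ℤ.-≤+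

rank-≥ : ∀ {G D r k} → Rank G D r → LinSysNonempty G D → RankCond G D k → + k ≤ r
rank-≥ (inj₁ (empty , _))                   L rc = contradiction L empty
rank-≥ (inj₂ (_ , _ , refl , _ , maximal)) L rc = ℤ.+≤+ (maximal _ rc)

module _ {H G : Graph} (ι : Subgraph H G) where

  φ-injective : Injective _≡_ _≡_ (φ ι)
  φ-injective = φ-inj ι _ _

  ψ-injective : Injective _≡_ _≡_ (ψ ι)
  ψ-injective = ψ-inj ι _ _

  push-hit : ∀ D x → push ι D (φ ι x) ≡ D x
  push-hit = extend-hit (φ ι) φ-injective

  inc-along : ∀ e → inc G (ψ ι e) ≋ push ι (inc H e)
  inc-along e w = begin
    δ (src G (ψ ι e)) w - δ (tgt G (ψ ι e)) w
      ≡⟨ cong₂ (λ s t → δ s w - δ t w) (src-ψ ι e) (tgt-ψ ι e) ⟩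
    δ (φ ι (src H e)) w - δ (φ ι (tgt H e)) w
      ≡⟨ sym (cong₂ _-_ (extend-δ (φ ι) φ-injective (src H e) w) (extend-δ (φ ι) φ-injective (tgt H e) w)) ⟩
    push ι (δ (src H e)) w - push ι (δ (tgt H e)) w
      ≡⟨ sym (extend-- (φ ι) (δ (src H e)) (δ (tgt H e)) w) ⟩
    push ι (inc H e) w ∎
    where open ≡-Reasoning

  gradient-along : ∀ c e → gradient G c (ψ ι e) ≡ gradient H (c ∘ φ ι) e
  gradient-along c e = cong₂ _-_ (cong c (tgt-ψ ι e)) (cong c (src-ψ ι e))

  push-prinDiv : ∀ c w →
    push ι (prinDiv H (c ∘ φ ι)) w ≡ sumℤ (λ e → gradient G c (ψ ι e) * inc G (ψ ι e) w)
  push-prinDiv c w = begin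
    push ι (prinDiv H (c ∘ φ ι)) w
      ≡⟨ extend-cong (φ ι) (prinDiv-edges H (c ∘ φ ι)) w ⟩
    push ι (λ x → sumℤ (λ e → gradient H (c ∘ φ ι) e * inc H e x)) w
      ≡⟨ extend-lincomb (φ ι) (gradient H (c ∘ φ ι)) (inc H) w ⟩
    sumℤ (λ e → gradient H (c ∘ φ ι) e * push ι (inc H e) w)
      ≡⟨ sum-cong (λ e → sym (cong₂ _*_ (gradient-along c e) (inc-along e w))) ⟩
    sumℤ (λ e → gradient G c (ψ ι e) * inc G (ψ ι e) w) ∎
    where open ≡-Reasoning

-- The decomposition G = H₁ ∨ H₂ at v; all statements are about the side H₁ or symmetric.

module Wedge {G : Graph} {v : Vtx G} (d : Decomposition G v) where
  open Decomposition d

  v₁ : Vtx H₁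
  v₁ = proj₁ v∈H₁

  v₂ : Vtx H₂
  v₂ = proj₁ v∈H₂

  v₁↦v : φ ι₁ v₁ ≡ v
  v₁↦v = proj₂ v∈H₁

  v₂↦v : φ ι₂ v₂ ≡ v
  v₂↦v = proj₂ v∈H₂

  shared₁ : ∀ {x y} → φ ι₁ x ≡ φ ι₂ y → x ≡ v₁
  shared₁ {x} {y} e = φ-injective ι₁ (trans (V-meet x y e) (sym v₁↦v))

  shared₂ : ∀ {x y} → φ ι₁ x ≡ φ ι₂ y → y ≡ v₂
  shared₂ {x} {y} e = φ-injective ι₂ (trans (sym e) (trans (V-meet x y e) (sym v₂↦v)))

  ⊞-at-v : ∀ A B → (A ⊞ B) v ≡ A v₁ + B v₂
  ⊞-at-v A B = cong₂ _+_ (trans (cong (push ι₁ A) (sym v₁↦v)) (push-hit ι₁ A v₁))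
                         (trans (cong (push ι₂ B) (sym v₂↦v)) (push-hit ι₂ B v₂))

  ⊞-on-H₁ : ∀ A B {x} → x ≢ v₁ → (A ⊞ B) (φ ι₁ x) ≡ A x
  ⊞-on-H₁ A B {x} x≢v₁ =
    trans (cong₂ _+_ (push-hit ι₁ A x) (extend-miss (φ ι₂) B (λ y e → x≢v₁ (shared₁ (sym e)))))
          (ℤP.+-identityʳ (A x))

  ⊞-on-H₂ : ∀ A B {y} → y ≢ v₂ → (A ⊞ B) (φ ι₂ y) ≡ B y
  ⊞-on-H₂ A B {y} y≢v₂ =
    trans (cong₂ _+_ (extend-miss (φ ι₁) A (λ x e → y≢v₂ (shared₂ e))) (push-hit ι₂ B y))
          (ℤP.+-identityˡ (B y))

  ⊞-restrict₁ : ∀ A B → B v₂ ≡ 0ℤ → ∀ x → (A ⊞ B) (φ ι₁ x) ≡ A x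
  ⊞-restrict₁ A B Bv≡0 x with x ≟ v₁
  ... | yes refl = trans (cong (A ⊞ B) v₁↦v)
                         (trans (⊞-at-v A B) (trans (cong (_+_ (A v₁)) Bv≡0) (ℤP.+-identityʳ (A v₁))))
  ... | no x≢v₁  = ⊞-on-H₁ A B x≢v₁

  ⊞-restrict₂ : ∀ A B → A v₁ ≡ 0ℤ → ∀ y → (A ⊞ B) (φ ι₂ y) ≡ B y
  ⊞-restrict₂ A B Av≡0 y with y ≟ v₂
  ... | yes refl = trans (cong (A ⊞ B) v₂↦v)
                         (trans (⊞-at-v A B) (trans (cong (_+ B v₂) Av≡0) (ℤP.+-identityˡ (B v₂))))
  ... | no y≢v₂  = ⊞-on-H₂ A B y≢v₂

  ⊞-cong : ∀ {A A' B B'} → A ≋ A' → B ≋ B' → A ⊞ B ≋ A' ⊞ B'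
  ⊞-cong A≋A' B≋B' w = cong₂ _+_ (extend-cong (φ ι₁) A≋A' w) (extend-cong (φ ι₂) B≋B' w)

  ⊞-hom : ∀ A A' B B' → (A +ᴰ A') ⊞ (B +ᴰ B') ≋ (A ⊞ B) +ᴰ (A' ⊞ B')
  ⊞-hom A A' B B' w =
    trans (cong₂ _+_ (extend-+ (φ ι₁) A A' w) (extend-+ (φ ι₂) B B' w))
          (interchange (push ι₁ A w) (push ι₁ A' w) (push ι₂ B w) (push ι₂ B' w))
    where interchange : ∀ a a' b b' → (a + a') + (b + b') ≡ (a + b) + (a' + b')
          interchange = solve-∀

  ⊞-sub : ∀ A A' B B' → (A -ᴰ A') ⊞ (B -ᴰ B') ≋ (A ⊞ B) -ᴰ (A' ⊞ B')
  ⊞-sub A A' B B' w =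
    trans (cong₂ _+_ (extend-- (φ ι₁) A A' w) (extend-- (φ ι₂) B B' w))
          (interchange (push ι₁ A w) (push ι₁ A' w) (push ι₂ B w) (push ι₂ B' w))
    where interchange : ∀ a a' b b' → (a - a') + (b - b') ≡ (a + b) - (a' + b')
          interchange = solve-∀

  ⊞-difference : ∀ {A A' B B'} → A ⊞ B ≋ A' ⊞ B' → (A -ᴰ A') ⊞ (B -ᴰ B') ≋ 0ᴰ
  ⊞-difference {A} {A'} {B} {B'} e w =
    trans (⊞-sub A A' B B' w) (trans (cong (_-_ ((A ⊞ B) w)) (sym (e w))) (ℤP.+-inverseʳ ((A ⊞ B) w)))

  deg-⊞ : ∀ A B → deg (A ⊞ B) ≡ deg A + deg B
  deg-⊞ A B = trans (sum-+ (push ι₁ A) (push ι₂ B))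
                    (cong₂ _+_ (sum-extend (φ ι₁) (φ-injective ι₁) A) (sum-extend (φ ι₂) (φ-injective ι₂) B))

  ⊞-effective : ∀ {A B} → Effective A → Effective B → Effective (A ⊞ B)
  ⊞-effective {A} {B} A≥0 B≥0 w =
    ℤP.+-mono-≤ (extend-effective (φ ι₁) A A≥0 w) (extend-effective (φ ι₂) B B≥0 w)

  split₁ : Div G → Div H₁
  split₁ D = D ∘ φ ι₁

  split₂ : Div G → Div H₂
  split₂ D = (D -ᴰ push ι₁ (split₁ D)) ∘ φ ι₂

  split-⊞ : ∀ D → split₁ D ⊞ split₂ D ≋ D
  split-⊞ D w with preimage (φ ι₂) w in eq
  ... | just y  = trans (cong (λ u → push ι₁ (split₁ D) u + split₂ D y) (sym y↦w))
                        (trans (cancel (push ι₁ (split₁ D) (φ ι₂ y)) (D (φ ι₂ y))) (cong D y↦w))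
    where
    y↦w : φ ι₂ y ≡ w
    y↦w = preimage-just (φ ι₂) eq
    cancel : ∀ p d → p + (d - p) ≡ d
    cancel = solve-∀
  ... | nothing with V-cover w
  ...   | inj₁ (x , refl) = trans (ℤP.+-identityʳ _) (push-hit ι₁ (split₁ D) x)
  ...   | inj₂ (y , y↦w)  = contradiction y↦w (preimage-nothing (φ ι₂) eq y)

  split-effective : ∀ {D} → Effective D → Effective (split₁ D) × Effective (split₂ D)
  split-effective {D} D≥0 = (λ x → D≥0 (φ ι₁ x)) , (λ y → residual-effective (φ ι₁) D D≥0 (φ ι₂ y))

  kernelMap : ℤ → Div H₁ × Div H₂
  kernelMap a = point v₁ a , point v₂ (- a)

  kernelMap-⊞ : ∀ a → point v₁ a ⊞ point v₂ (- a) ≋ 0ᴰ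
  kernelMap-⊞ a w = begin
    push ι₁ (point v₁ a) w + push ι₂ (point v₂ (- a)) w
      ≡⟨ cong₂ _+_ (extend-point (φ ι₁) (φ-injective ι₁) v₁ a w) (extend-point (φ ι₂) (φ-injective ι₂) v₂ (- a) w) ⟩
    a * δ (φ ι₁ v₁) w + - a * δ (φ ι₂ v₂) w
      ≡⟨ cong₂ (λ s t → a * δ s w + - a * δ t w) v₁↦v v₂↦v ⟩
    a * δ v w + - a * δ v w
      ≡⟨ cancel a (δ v w) ⟩
    0ℤ ∎
    where
    open ≡-Reasoning
    cancel : ∀ a t → a * t + - a * t ≡ 0ℤ
    cancel = solve-∀

  kernelMap-hom : ∀ a b → (point v₁ (a + b) ≋ point v₁ a +ᴰ point v₁ b)
                        × (point v₂ (- (a + b)) ≋ point v₂ (- a) +ᴰ point v₂ (- b))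
  kernelMap-hom a b =
    point-+ v₁ a b , λ y → trans (cong (λ t → point v₂ t y) (ℤP.neg-distrib-+ a b)) (point-+ v₂ (- a) (- b) y)

  kernelMap-injective : ∀ a b → point v₁ a ≋ point v₁ b → a ≡ b
  kernelMap-injective a b e = trans (sym (point-at v₁ a)) (trans (e v₁) (point-at v₁ b))

  kernelMap-nonprincipal : ∀ a → IsPrin H₁ (point v₁ a) → a ≡ 0ℤ
  kernelMap-nonprincipal a a-prin = trans (sym (deg-point v₁ a)) (deg-prin a-prin)

  -- Conversely every kernel element is of that form: off v both parts vanish.
  kernel-point : ∀ {A B} → A ⊞ B ≋ 0ᴰ → (point v₁ (A v₁) ≋ A) × (point v₂ (- A v₁) ≋ B)
  kernel-point {A} {B} A⊞B≋0 = on-H₁ , on-H₂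
    where
    on-H₁ : point v₁ (A v₁) ≋ A
    on-H₁ x with v₁ ≟ x
    ... | yes refl = ℤP.*-identityʳ (A v₁)
    ... | no v₁≢x  = trans (ℤP.*-zeroʳ (A v₁))
                           (sym (trans (sym (⊞-on-H₁ A B (v₁≢x ∘ sym))) (A⊞B≋0 (φ ι₁ x))))
    on-H₂ : point v₂ (- A v₁) ≋ B
    on-H₂ y with v₂ ≟ y
    ... | yes refl = trans (ℤP.*-identityʳ (- A v₁))
                           (sym (inverseʳ-unique (A v₁) (B v₂) (trans (sym (⊞-at-v A B)) (A⊞B≋0 v))))
    ... | no v₂≢y  = trans (ℤP.*-zeroʳ (- A v₁))
                           (sym (trans (sym (⊞-on-H₂ A B (v₂≢y ∘ sym))) (A⊞B≋0 (φ ι₂ y))))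

  -- A kernel element with a principal component vanishes (principal divisors have degree 0).
  kernel-trivial : ∀ {A B} → A ⊞ B ≋ 0ᴰ → IsPrin H₁ A ⊎ IsPrin H₂ B → (A ≋ 0ᴰ) × (B ≋ 0ᴰ)
  kernel-trivial {A} {B} A⊞B≋0 principal =
    (λ x → trans (sym (on-H₁ x)) (cong (λ a → point v₁ a x) (a≡0 principal))) ,
    (λ y → trans (sym (on-H₂ y)) (cong (λ a → point v₂ (- a) y) (a≡0 principal)))
    where
    on-H₁ : point v₁ (A v₁) ≋ A
    on-H₁ = proj₁ (kernel-point A⊞B≋0)
    on-H₂ : point v₂ (- A v₁) ≋ B
    on-H₂ = proj₂ (kernel-point A⊞B≋0)
    a≡0 : IsPrin H₁ A ⊎ IsPrin H₂ B → A v₁ ≡ 0ℤ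
    a≡0 (inj₁ A-prin) = trans (sym (deg-point v₁ (A v₁))) (trans (sum-cong on-H₁) (deg-prin A-prin))
    a≡0 (inj₂ B-prin) =
      ℤP.neg-injective (trans (sym (deg-point v₂ (- A v₁))) (trans (sum-cong on-H₂) (deg-prin B-prin)))

  sum-edges : ∀ (f : Edg G → ℤ) → sumℤ f ≡ sumℤ (f ∘ ψ ι₁) + sumℤ (f ∘ ψ ι₂)
  sum-edges f = begin
    sumℤ f
      ≡⟨ sum-cong partition ⟩
    sumℤ (extend (ψ ι₁) (f ∘ ψ ι₁) +ᴰ extend (ψ ι₂) (f ∘ ψ ι₂))
      ≡⟨ sum-+ (extend (ψ ι₁) (f ∘ ψ ι₁)) (extend (ψ ι₂) (f ∘ ψ ι₂)) ⟩
    sumℤ (extend (ψ ι₁) (f ∘ ψ ι₁)) + sumℤ (extend (ψ ι₂) (f ∘ ψ ι₂))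
      ≡⟨ cong₂ _+_ (sum-extend (ψ ι₁) (ψ-injective ι₁) (f ∘ ψ ι₁))
                   (sum-extend (ψ ι₂) (ψ-injective ι₂) (f ∘ ψ ι₂)) ⟩
    sumℤ (f ∘ ψ ι₁) + sumℤ (f ∘ ψ ι₂) ∎
    where
    open ≡-Reasoning
    partition : f ≋ extend (ψ ι₁) (f ∘ ψ ι₁) +ᴰ extend (ψ ι₂) (f ∘ ψ ι₂)
    partition e with E-cover e
    ... | inj₁ (e₁ , refl) = sym (trans (cong₂ _+_ (extend-hit (ψ ι₁) (ψ-injective ι₁) (f ∘ ψ ι₁) e₁)
                                                   (extend-miss (ψ ι₂) (f ∘ ψ ι₂) (λ e₂ e → E-disj e₁ e₂ (sym e))))
                                        (ℤP.+-identityʳ _))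
    ... | inj₂ (e₂ , refl) = sym (trans (cong₂ _+_ (extend-miss (ψ ι₁) (f ∘ ψ ι₁) (λ e₁ e → E-disj e₁ e₂ e))
                                                   (extend-hit (ψ ι₂) (ψ-injective ι₂) (f ∘ ψ ι₂) e₂))
                                        (ℤP.+-identityˡ _))

  prinDiv-⊞ : ∀ c → prinDiv G c ≋ prinDiv H₁ (c ∘ φ ι₁) ⊞ prinDiv H₂ (c ∘ φ ι₂)
  prinDiv-⊞ c w =
    trans (prinDiv-edges G c w)
          (trans (sum-edges (λ e → gradient G c e * inc G e w))
                 (sym (cong₂ _+_ (push-prinDiv ι₁ c w) (push-prinDiv ι₂ c w))))

  -- Prin(H₁) ⊕ Prin(H₂) → Prin(G): glue coefficient vectors normalized to vanish at v.
  prin-⊞ : ∀ {P₁ P₂} → IsPrin H₁ P₁ → IsPrin H₂ P₂ → IsPrin G (P₁ ⊞ P₂)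
  prin-⊞ {P₁} {P₂} P₁-prin P₂-prin = glue (prin-normalize P₁-prin v₁) (prin-normalize P₂-prin v₂)
    where
    glue : (Σ (Vtx H₁ → ℤ) λ c₁ → c₁ v₁ ≡ 0ℤ × (P₁ ≋ prinDiv H₁ c₁)) →
           (Σ (Vtx H₂ → ℤ) λ c₂ → c₂ v₂ ≡ 0ℤ × (P₂ ≋ prinDiv H₂ c₂)) → IsPrin G (P₁ ⊞ P₂)
    glue (c₁ , c₁v≡0 , P₁≋) (c₂ , c₂v≡0 , P₂≋) =
      c₁ ⊞ c₂ , λ w → trans (⊞-cong P₁≋ P₂≋ w)
                     (sym (trans (prinDiv-⊞ (c₁ ⊞ c₂) w)
                                 (⊞-cong (prinDiv-cong H₁ (⊞-restrict₁ c₁ c₂ c₂v≡0))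
                                         (prinDiv-cong H₂ (⊞-restrict₂ c₁ c₂ c₁v≡0)) w)))

  -- Prin(G) → Prin(H₁) ⊕ Prin(H₂): restrict the coefficient vector.
  PrinSplitting : Div G → Set
  PrinSplitting P = Σ (Div H₁) λ P₁ → Σ (Div H₂) λ P₂ → IsPrin H₁ P₁ × IsPrin H₂ P₂ × (P₁ ⊞ P₂ ≋ P)

  prin-split : ∀ P → IsPrin G P → PrinSplitting P
  prin-split P (c , P≡) =
    prinDiv H₁ (c ∘ φ ι₁) , prinDiv H₂ (c ∘ φ ι₂) , (c ∘ φ ι₁ , λ _ → refl) , (c ∘ φ ι₂ , λ _ → refl) ,
    λ w → sym (trans (P≡ w) (prinDiv-⊞ c w))

  prin-⊞-injective : ∀ P₁ P₁' P₂ P₂' → IsPrin H₁ P₁ → IsPrin H₂ P₂ → IsPrin H₁ P₁' → IsPrin H₂ P₂' →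
    P₁ ⊞ P₂ ≋ P₁' ⊞ P₂' → (P₁ ≋ P₁') × (P₂ ≋ P₂')
  prin-⊞-injective P₁ P₁' P₂ P₂' P₁-prin _ P₁'-prin _ e =
    (λ x → ℤP.i-j≡0⇒i≡j (P₁ x) (P₁' x) (proj₁ vanish x)) ,
    (λ y → ℤP.i-j≡0⇒i≡j (P₂ y) (P₂' y) (proj₂ vanish y))
    where
    vanish : ((P₁ -ᴰ P₁') ≋ 0ᴰ) × ((P₂ -ᴰ P₂') ≋ 0ᴰ)
    vanish = kernel-trivial (⊞-difference e) (inj₁ (prin-sub P₁-prin P₁'-prin))

  linEq-⊞ : ∀ {D₁ D₁' D₂ D₂'} → LinEq H₁ D₁ D₁' → LinEq H₂ D₂ D₂' → LinEq G (D₁ ⊞ D₂) (D₁' ⊞ D₂')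
  linEq-⊞ {D₁} {D₁'} {D₂} {D₂'} p q = prin-resp (prin-⊞ p q) (⊞-sub D₁ D₁' D₂ D₂')

  jac-surjective : ∀ D → LinEq G D (split₁ D ⊞ split₂ D)
  jac-surjective D = prin-zero _ λ w → trans (cong (_-_ (D w)) (split-⊞ D w)) (ℤP.+-inverseʳ (D w))

  jac-exact : ∀ D₁ D₂ → IsPrin G (D₁ ⊞ D₂) →
    Σ ℤ λ a → LinEq H₁ D₁ (point v₁ a) × LinEq H₂ D₂ (point v₂ (- a))
  jac-exact D₁ D₂ D-prin = from-splitting (prin-split (D₁ ⊞ D₂) D-prin)
    where
    remainder : ∀ {n} {D P K : Fin n → ℤ} → K ≋ D -ᴰ P → P ≋ D -ᴰ K
    remainder {D = D} {P} {K} K≋D-P u = trans (undo (D u) (P u)) (cong (_-_ (D u)) (sym (K≋D-P u)))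
      where undo : ∀ d p → p ≡ d - (d - p)
            undo = solve-∀
    from-splitting : PrinSplitting (D₁ ⊞ D₂) →
      Σ ℤ λ a → LinEq H₁ D₁ (point v₁ a) × LinEq H₂ D₂ (point v₂ (- a))
    from-splitting (P₁ , P₂ , P₁-prin , P₂-prin , P≋D) =
      (D₁ -ᴰ P₁) v₁ , prin-resp P₁-prin (remainder {D = D₁} on-H₁) , prin-resp P₂-prin (remainder {D = D₂} on-H₂)
      where
      kernel : (D₁ -ᴰ P₁) ⊞ (D₂ -ᴰ P₂) ≋ 0ᴰ
      kernel = ⊞-difference (λ w → sym (P≋D w))
      on-H₁ : point v₁ ((D₁ -ᴰ P₁) v₁) ≋ D₁ -ᴰ P₁
      on-H₁ = proj₁ (kernel-point kernel)
      on-H₂ : point v₂ (- (D₁ -ᴰ P₁) v₁) ≋ D₂ -ᴰ P₂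
      on-H₂ = proj₂ (kernel-point kernel)

  push₁-as-⊞ : ∀ D → push ι₁ D ≋ D ⊞ 0ᴰ
  push₁-as-⊞ D w = sym (trans (cong (_+_ (push ι₁ D w)) (extend-0 (φ ι₂) w)) (ℤP.+-identityʳ _))

  push₁-prin : ∀ P → IsPrin H₁ P → IsPrin G (push ι₁ P)
  push₁-prin P P-prin = prin-resp (prin-⊞ P-prin (prin-zero 0ᴰ λ _ → refl)) (λ w → sym (push₁-as-⊞ P w))

  push₁-injective : ∀ P P' → push ι₁ P ≋ push ι₁ P' → P ≋ P'
  push₁-injective P P' e x = trans (sym (push-hit ι₁ P x)) (trans (e (φ ι₁ x)) (push-hit ι₁ P' x))

  push₁-linEq : ∀ D D' → LinEq H₁ D D' → LinEq G (push ι₁ D) (push ι₁ D')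
  push₁-linEq D D' D~D' = prin-resp (push₁-prin (D -ᴰ D') D~D') (extend-- (φ ι₁) D D')

  push₁-reflects-linEq : ∀ D D' → LinEq G (push ι₁ D) (push ι₁ D') → LinEq H₁ D D'
  push₁-reflects-linEq D D' pushD~pushD' = from-splitting (prin-split _ pushD~pushD')
    where
    from-splitting : PrinSplitting (push ι₁ D -ᴰ push ι₁ D') → LinEq H₁ D D'
    from-splitting (P₁ , P₂ , P₁-prin , P₂-prin , P≋) =
      prin-resp P₁-prin (λ x → sym (ℤP.i-j≡0⇒i≡j ((D -ᴰ D') x) (P₁ x) (proj₁ vanish x)))
      where
      as-⊞ : (D -ᴰ D') ⊞ 0ᴰ ≋ P₁ ⊞ P₂
      as-⊞ w = trans (sym (push₁-as-⊞ (D -ᴰ D') w)) (trans (extend-- (φ ι₁) D D' w) (sym (P≋ w)))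
      vanish : ((D -ᴰ D') -ᴰ P₁ ≋ 0ᴰ) × (0ᴰ -ᴰ P₂ ≋ 0ᴰ)
      vanish = kernel-trivial (⊞-difference as-⊞) (inj₂ (prin-sub (prin-zero 0ᴰ λ _ → refl) P₂-prin))

  linsys-⊞ : ∀ {A B} → LinSysNonempty H₁ A → LinSysNonempty H₂ B → LinSysNonempty G (A ⊞ B)
  linsys-⊞ (F₁ , F₁≥0 , F₁~A) (F₂ , F₂≥0 , F₂~B) = F₁ ⊞ F₂ , ⊞-effective F₁≥0 F₂≥0 , linEq-⊞ F₁~A F₂~B

  rankcond-⊞ : ∀ {D₁ D₂ k₁ k₂ k} → RankCond H₁ D₁ k₁ → RankCond H₂ D₂ k₂ →
    k ℕ.≤ k₁ → k ℕ.≤ k₂ → RankCond G (D₁ ⊞ D₂) k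
  rankcond-⊞ {D₁} {D₂} {k₁} {k₂} {k} rc₁ rc₂ k≤k₁ k≤k₂ E E≥0 degE≡k =
    linsys-resp remove-E
      (linsys-⊞ (rankcond-≤ v₁ {D = D₁} rc₁ E₁ E₁≥0 (bound E₁≥0 E₂≥0 degE₁+degE₂ k≤k₁))
                (rankcond-≤ v₂ {D = D₂} rc₂ E₂ E₂≥0
                            (bound E₂≥0 E₁≥0 (trans (ℤP.+-comm (deg E₂) (deg E₁)) degE₁+degE₂) k≤k₂)))
    where
    E₁ : Div H₁
    E₁ = split₁ E
    E₂ : Div H₂
    E₂ = split₂ E
    E₁≥0 : Effective E₁
    E₁≥0 = proj₁ (split-effective E≥0)
    E₂≥0 : Effective E₂
    E₂≥0 = proj₂ (split-effective E≥0)
    degE₁+degE₂ : deg E₁ + deg E₂ ≡ + k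
    degE₁+degE₂ = trans (sym (deg-⊞ E₁ E₂)) (trans (sum-cong (split-⊞ E)) degE≡k)
    bound : ∀ {m n} {X : Fin m → ℤ} {Y : Fin n → ℤ} {kⱼ} → Effective X → Effective Y →
      deg X + deg Y ≡ + k → k ℕ.≤ kⱼ → deg X ≤ + kⱼ
    bound {X = X} {Y} X≥0 Y≥0 sum≡k k≤kⱼ =
      ℤP.≤-trans (ℤP.≤-trans (ℤP.≤-reflexive (sym (ℤP.+-identityʳ (deg X))))
                             (ℤP.+-monoʳ-≤ (deg X) (sum-nonneg Y Y≥0)))
                 (ℤP.≤-trans (ℤP.≤-reflexive sum≡k) (ℤ.+≤+ k≤kⱼ))
    remove-E : (D₁ -ᴰ E₁) ⊞ (D₂ -ᴰ E₂) ≋ (D₁ ⊞ D₂) -ᴰ E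
    remove-E w = trans (⊞-sub D₁ E₁ D₂ E₂ w) (cong (_-_ ((D₁ ⊞ D₂) w)) (split-⊞ E w))

  rank-⊞ : ∀ D₁ D₂ r r₁ r₂ → Rank G (D₁ ⊞ D₂) r → Rank H₁ D₁ r₁ → Rank H₂ D₂ r₂ → r₁ ⊓ r₂ ≤ r
  rank-⊞ D₁ D₂ r _ r₂ R (inj₁ (_ , refl)) R₂ = ℤP.≤-trans (ℤP.i⊓j≤i -1ℤ r₂) (rank-≥-1 R)
  rank-⊞ D₁ D₂ r r₁ _ R (inj₂ _) (inj₁ (_ , refl)) = ℤP.≤-trans (ℤP.i⊓j≤j r₁ -1ℤ) (rank-≥-1 R)
  rank-⊞ D₁ D₂ r _ _ R (inj₂ (L₁ , k₁ , refl , rc₁ , _)) (inj₂ (L₂ , k₂ , refl , rc₂ , _)) =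
    rank-≥ R (linsys-⊞ L₁ L₂) (rankcond-⊞ rc₁ rc₂ (ℕP.m⊓n≤m k₁ k₂) (ℕP.m⊓n≤n k₁ k₂))

  -- Ranks, part (4): an effective divisor of G equivalent to ι¹_* A gives one of H₁ equivalent to A.
  -- If A + B ≥ 0 with B principal on H₂ then A ≥ 0: B is nonnegative off v and has degree 0.
  effective-cofactor : ∀ {A B} → Effective (A ⊞ B) → IsPrin H₂ B → Effective A
  effective-cofactor {A} {B} A⊞B≥0 B-prin x with x ≟ v₁
  ... | no x≢v₁  = subst (0ℤ ≤_) (⊞-on-H₁ A B x≢v₁) (A⊞B≥0 (φ ι₁ x))
  ... | yes refl = drop (subst (0ℤ ≤_) (⊞-at-v A B) (A⊞B≥0 v)) Bv≤0
    where
    B≥0-off-v : ∀ y → y ≢ v₂ → 0ℤ ≤ B y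
    B≥0-off-v y y≢v₂ = subst (0ℤ ≤_) (⊞-on-H₂ A B y≢v₂) (A⊞B≥0 (φ ι₂ y))
    Bv≤0 : B v₂ ≤ 0ℤ
    Bv≤0 = subst (B v₂ ≤_) (deg-prin B-prin) (term-≤-sum B v₂ B≥0-off-v)
    drop : ∀ {a b} → 0ℤ ≤ a + b → b ≤ 0ℤ → 0ℤ ≤ a
    drop {a} {b} 0≤a+b b≤0 =
      ℤP.≤-trans 0≤a+b (ℤP.≤-trans (ℤP.+-monoʳ-≤ a b≤0) (ℤP.≤-reflexive (ℤP.+-identityʳ a)))

  linsys-pull : ∀ A → LinSysNonempty G (push ι₁ A) → LinSysNonempty H₁ A
  linsys-pull A (F , F≥0 , F~A) = from-splitting (prin-split _ F~A)
    where
    added : ∀ a p → (a + p) - a ≡ p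
    added = solve-∀
    regroup : ∀ a p q f → p + q ≡ f - a → a + p + q ≡ f
    regroup a p q f e = trans (ℤP.+-assoc a p q) (trans (cong (_+_ a) e) (cancel a f))
      where cancel : ∀ a f → a + (f - a) ≡ f
            cancel = solve-∀
    from-splitting : PrinSplitting (F -ᴰ push ι₁ A) → LinSysNonempty H₁ A
    from-splitting (P₁ , P₂ , P₁-prin , P₂-prin , P≋) =
      A +ᴰ P₁ , effective-cofactor (λ w → subst (0ℤ ≤_) (sym (as-⊞ w)) (F≥0 w)) P₂-prin ,
      prin-resp P₁-prin (λ x → sym (added (A x) (P₁ x)))
      where
      as-⊞ : (A +ᴰ P₁) ⊞ P₂ ≋ F
      as-⊞ w = trans (cong (_+ push ι₂ P₂ w) (extend-+ (φ ι₁) A P₁ w))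
                     (regroup (push ι₁ A w) (push ι₁ P₁ w) (push ι₂ P₂ w) (F w) (P≋ w))

  rankcond-pull : ∀ {D k} → RankCond G (push ι₁ D) k → RankCond H₁ D k
  rankcond-pull {D} rc E E≥0 degE≡k =
    linsys-pull (D -ᴰ E)
      (linsys-resp (λ w → sym (extend-- (φ ι₁) D E w))
        (rc (push ι₁ E) (extend-effective (φ ι₁) E E≥0) (trans (sum-extend (φ ι₁) (φ-injective ι₁) E) degE≡k)))

  rank-pull : ∀ D r r' → Rank H₁ D r → Rank G (push ι₁ D) r' → r' ≤ r
  rank-pull D r _ R (inj₁ (_ , refl))                = rank-≥-1 R
  rank-pull D r _ R (inj₂ (L , k , refl , rc , _)) = rank-≥ R (linsys-pull D L) (rankcond-pull rc)

  embedding₁ :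
      (∀ D D' → push ι₁ (D +ᴰ D') ≋ push ι₁ D +ᴰ push ι₁ D')
    × (∀ P → IsPrin H₁ P → IsPrin G (push ι₁ P))
    × (∀ P P' → IsPrin H₁ P → IsPrin H₁ P' → push ι₁ P ≋ push ι₁ P' → P ≋ P')
    × (∀ D D' → LinEq H₁ D D' → LinEq G (push ι₁ D) (push ι₁ D'))
    × (∀ D D' → LinEq G (push ι₁ D) (push ι₁ D') → LinEq H₁ D D')
  embedding₁ =
    extend-+ (φ ι₁) , push₁-prin , (λ P P' _ _ → push₁-injective P P') , push₁-linEq , push₁-reflects-linEq

swap : ∀ {G v} → Decomposition G v → Decomposition G v
swap d = record
  { H₁ = H₂ ; H₂ = H₁ ; conn₁ = conn₂ ; conn₂ = conn₁ ; ι₁ = ι₂ ; ι₂ = ι₁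
  ; V-cover = Sum.swap ∘ V-cover
  ; v∈H₁ = v∈H₂ ; v∈H₂ = v∈H₁
  ; V-meet = λ y x e → trans e (V-meet x y (sym e))
  ; E-cover = Sum.swap ∘ E-cover
  ; E-disj = λ e₂ e₁ e → E-disj e₁ e₂ (sym e) }
  where open Decomposition d

lemma2p5 :
    (G : Graph) (v : Vtx G) → Connected G → IsCutVertex G v →
    (d : Decomposition G v) →
    let open Decomposition d in
    -- (1) the map (D₁ , D₂) ↦ D₁ + D₂
    -- homomorphism
    ( (∀ (D₁ D₁' : Div H₁) (D₂ D₂' : Div H₂) →
         ((D₁ +ᴰ D₁') ⊞ (D₂ +ᴰ D₂')) ≋ ((D₁ ⊞ D₂) +ᴰ (D₁' ⊞ D₂')))
    -- surjective
    × (∀ (D : Div G) → Σ (Div H₁) λ D₁ → Σ (Div H₂) λ D₂ → (D₁ ⊞ D₂) ≋ D)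
    -- kernel ≅ ℤ via some f, and the exact sequence 0 → ℤ → Jac H₁ ⊕ Jac H₂ → Jac G → 0
    × Σ (ℤ → Div H₁ × Div H₂) (λ f →
        -- f is a homomorphism
        (∀ a b → (proj₁ (f (a + b)) ≋ (proj₁ (f a) +ᴰ proj₁ (f b)))
               × (proj₂ (f (a + b)) ≋ (proj₂ (f a) +ᴰ proj₂ (f b))))
        -- f injective
      × (∀ a b → proj₁ (f a) ≋ proj₁ (f b) → proj₂ (f a) ≋ proj₂ (f b) → a ≡ b)
        -- image of f ⊆ kernel
      × (∀ a → (proj₁ (f a) ⊞ proj₂ (f a)) ≋ 0ᴰ)
        -- kernel ⊆ image of f
      × (∀ (D₁ : Div H₁) (D₂ : Div H₂) → (D₁ ⊞ D₂) ≋ 0ᴰ →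
           Σ ℤ λ a → (proj₁ (f a) ≋ D₁) × (proj₂ (f a) ≋ D₂))
        -- exactness at ℤ: ℤ → Jac H₁ ⊕ Jac H₂ injective
      × (∀ a → IsPrin H₁ (proj₁ (f a)) → IsPrin H₂ (proj₂ (f a)) → a ≡ 0ℤ)
        -- exactness at Jac H₁ ⊕ Jac H₂
      × (∀ (D₁ : Div H₁) (D₂ : Div H₂) → IsPrin G (D₁ ⊞ D₂) →
           Σ ℤ λ a → LinEq H₁ D₁ (proj₁ (f a)) × LinEq H₂ D₂ (proj₂ (f a))))
    -- the induced map Jac H₁ ⊕ Jac H₂ → Jac G is well defined
    × (∀ (D₁ D₁' : Div H₁) (D₂ D₂' : Div H₂) →
         LinEq H₁ D₁ D₁' → LinEq H₂ D₂ D₂' → LinEq G (D₁ ⊞ D₂) (D₁' ⊞ D₂'))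
    -- and surjective (exactness at Jac G)
    × (∀ (D : Div G) → Σ (Div H₁) λ D₁ → Σ (Div H₂) λ D₂ → LinEq G D (D₁ ⊞ D₂))
    -- Prin H₁ ⊕ Prin H₂ ≅ Prin G : maps into, injective, surjective
    × (∀ (P₁ : Div H₁) (P₂ : Div H₂) → IsPrin H₁ P₁ → IsPrin H₂ P₂ → IsPrin G (P₁ ⊞ P₂))
    × (∀ (P₁ P₁' : Div H₁) (P₂ P₂' : Div H₂) →
         IsPrin H₁ P₁ → IsPrin H₂ P₂ → IsPrin H₁ P₁' → IsPrin H₂ P₂' →
         (P₁ ⊞ P₂) ≋ (P₁' ⊞ P₂') → (P₁ ≋ P₁') × (P₂ ≋ P₂'))
    × (∀ (P : Div G) → IsPrin G P →
         Σ (Div H₁) λ P₁ → Σ (Div H₂) λ P₂ →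
           IsPrin H₁ P₁ × IsPrin H₂ P₂ × ((P₁ ⊞ P₂) ≋ P)) )
    -- (2) ι^j_* : homomorphism, Prin(H_j) → Prin(G), induced maps injective
    × (∀ (j : Fin 2) →
         (∀ (D D' : Div (Hj j)) →
            push (ιj j) (D +ᴰ D') ≋ (push (ιj j) D +ᴰ push (ιj j) D'))
       × (∀ (P : Div (Hj j)) → IsPrin (Hj j) P → IsPrin G (push (ιj j) P))
       × (∀ (P P' : Div (Hj j)) → IsPrin (Hj j) P → IsPrin (Hj j) P' →
            push (ιj j) P ≋ push (ιj j) P' → P ≋ P')
       × (∀ (D D' : Div (Hj j)) → LinEq (Hj j) D D' →
            LinEq G (push (ιj j) D) (push (ιj j) D'))
       × (∀ (D D' : Div (Hj j)) → LinEq G (push (ιj j) D) (push (ιj j) D') →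
            LinEq (Hj j) D D'))
    -- (3) r_G(D₁ + D₂) ≥ min (r_{H₁}(D₁), r_{H₂}(D₂))
    × (∀ (D₁ : Div H₁) (D₂ : Div H₂) (r r₁ r₂ : ℤ) →
         Rank G (D₁ ⊞ D₂) r → Rank H₁ D₁ r₁ → Rank H₂ D₂ r₂ → (r₁ ⊓ r₂) ≤ r)
    -- (4) r_{H_j}(D_j) ≥ r_G(ι^j_* D_j)
    × (∀ (j : Fin 2) (D : Div (Hj j)) (r r' : ℤ) →
         Rank (Hj j) D r → Rank G (push (ιj j) D) r' → r' ≤ r)
lemma2p5 G v _ _ d =
  ( ⊞-hom , (λ D → split₁ D , split₂ D , split-⊞ D) ,
    ( kernelMap , kernelMap-hom , (λ a b e _ → kernelMap-injective a b e) , kernelMap-⊞ ,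
      (λ D₁ D₂ D₁⊞D₂≋0 → D₁ v₁ , kernel-point D₁⊞D₂≋0) ,
      (λ a a-prin _ → kernelMap-nonprincipal a a-prin) , jac-exact ) ,
    (λ _ _ _ _ → linEq-⊞) , (λ D → split₁ D , split₂ D , jac-surjective D) ,
    (λ _ _ → prin-⊞) , prin-⊞-injective , prin-split ) ,
  (λ { zero → embedding₁ ; (suc zero) → Wedge.embedding₁ (swap d) }) ,
  rank-⊞ ,
  (λ { zero → rank-pull ; (suc zero) → Wedge.rank-pull (swap d) })
  where open Wedge d
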